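{- Let $(A,\rightarrow,\rightsquigarrow,0,1)$ be a bounded pseudo-BE algebra. Then every fantastic deductive system of $A$ is an involutive deductive system: $\mathcal{DS}_f(A)\subseteq\mathcal{DS}_i(A)$.
   Context: A pseudo-BE algebra is an algebra $(A,\rightarrow,\rightsquigarrow,1)$ of type $(2,2,0)$ such that for all $x,y,z\in A$: $x\rightarrow x=x\rightsquigarrow x=1$; $x\rightarrow 1=x\rightsquigarrow 1=1$; $1\rightarrow x=1\rightsquigarrow x=x$; $x\rightarrow(y\rightsquigarrow z)=y\rightsquigarrow(x\rightarrow z)$; $x\rightarrow y=1$ iff $x\rightsquigarrow y=1$. Write $x\le y$ iff $x\rightarrow y=1$. It is bounded if it has $0$ with $0\le x$ for all $x$; $x^-=x\rightarrow 0$, $x^\sim=x\rightsquigarrow 0$, $x^{ -\sim}=(x^-)^\sim$, $x^{\sim- }=(x^\sim)^-$. Put $x\vee_1 y=(x\rightarrow y)\rightsquigarrow y$, $x\vee_2 y=(x\rightsquigarrow y)\rightarrow y$. A deductive system is $D\subseteq A$ with $1\in D$ such that $x\in D$, $x\rightarrow y\in D$ imply $y\in D$. It is fantastic if for all $x,y$: $y\rightarrow x\in D$ implies $(x\vee_1 y)\rightarrow x\in D$, and $y\rightsquigarrow x\in D$ implies $(x\vee_2 y)\rightsquigarrow x\in D$. It is involutive if $x^{ -\sim}\rightarrow x\in D$ and $x^{\sim- }\rightsquigarrow x\in D$ for all $x$. $\mathcal{DS}_f(A)$, $\mathcal{DS}_i(A)$ denote the sets of fantastic and involutive deductive systems. 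-}

module Defs where

open import Level using (Level; _⊔_; suc)
open import Relation.Binary.PropositionalEquality using (_≡_)
open import Data.Product using (_×_)
open import Function.Bundles using (_⇔_)

record PseudoBEAlgebra (a : Level) : Set (suc a) where
  infixr 5 _⇒_ _⇝_
  field
    Carrier : Set a
    _⇒_ : Carrier → Carrier → Carrier
    _⇝_ : Carrier → Carrier → Carrier
    𝟙 : Carrier
    ⇒-refl : ∀ x → x ⇒ x ≡ 𝟙
    ⇝-refl : ∀ x → x ⇝ x ≡ 𝟙
    ⇒-top : ∀ x → x ⇒ 𝟙 ≡ 𝟙
    ⇝-top : ∀ x → x ⇝ 𝟙 ≡ 𝟙
    ⇒-unit : ∀ x → 𝟙 ⇒ x ≡ x
    ⇝-unit : ∀ x → 𝟙 ⇝ x ≡ x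
    exchange : ∀ x y z → x ⇒ (y ⇝ z) ≡ y ⇝ (x ⇒ z)
    ⇒-iff-⇝ : ∀ x y → (x ⇒ y ≡ 𝟙) ⇔ (x ⇝ y ≡ 𝟙)

  _≤_ : Carrier → Carrier → Set a
  x ≤ y = x ⇒ y ≡ 𝟙

  _∨₁_ : Carrier → Carrier → Carrier
  x ∨₁ y = (x ⇒ y) ⇝ y

  _∨₂_ : Carrier → Carrier → Carrier
  x ∨₂ y = (x ⇝ y) ⇒ y

record BoundedPseudoBEAlgebra (a : Level) : Set (suc a) where
  field
    pbe : PseudoBEAlgebra a
  open PseudoBEAlgebra pbe public
  field
    𝟘 : Carrier
    𝟘-least : ∀ x → 𝟘 ≤ x

  _⁻ : Carrier → Carrier
  x ⁻ = x ⇒ 𝟘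

  _˜ : Carrier → Carrier
  x ˜ = x ⇝ 𝟘

module _ {a : Level} (A : PseudoBEAlgebra a) where
  open PseudoBEAlgebra A

  record IsDeductiveSystem {ℓ : Level} (D : Carrier → Set ℓ) : Set (a ⊔ ℓ) where
    field
      contains-𝟙 : D 𝟙
      mp : ∀ {x y} → D x → D (x ⇒ y) → D y

  record IsFantasticDS {ℓ : Level} (D : Carrier → Set ℓ) : Set (a ⊔ ℓ) where
    field
      isDS : IsDeductiveSystem D
      fantastic₁ : ∀ x y → D (y ⇒ x) → D ((x ∨₁ y) ⇒ x)
      fantastic₂ : ∀ x y → D (y ⇝ x) → D ((x ∨₂ y) ⇝ x)

module _ {a : Level} (A : BoundedPseudoBEAlgebra a) where
  open BoundedPseudoBEAlgebra A

  record IsInvolutiveDS {ℓ : Level} (D : Carrier → Set ℓ) : Set (a ⊔ ℓ) where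
    field
      isDS : IsDeductiveSystem pbe D
      involutive₁ : ∀ x → D (((x ⁻) ˜) ⇒ x)
      involutive₂ : ∀ x → D (((x ˜) ⁻) ⇝ x)

module Submission where

open import Defs
open import Level using (Level)
open import Relation.Binary.PropositionalEquality using (subst; sym)
open import Function.Bundles using (Equivalence)

module _ {a ℓ : Level} (A : PseudoBEAlgebra a) {D : PseudoBEAlgebra.Carrier A → Set ℓ}
         (isDS : IsDeductiveSystem A D) where
  open PseudoBEAlgebra A
  open IsDeductiveSystem isDS

  ds-contains-≤ : ∀ {x y} → x ≤ y → D (x ⇒ y)
  ds-contains-≤ x≤y = subst D (sym x≤y) contains-𝟙

  ds-contains-≤˜ : ∀ {x y} → x ≤ y → D (x ⇝ y)
  ds-contains-≤˜ {x} {y} x≤y =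
    subst D (sym (Equivalence.to (⇒-iff-⇝ x y) x≤y)) contains-𝟙

-- The fantastic conditions at y = 0 are literally the involutive conditions,
-- since x⁻˜ ≡ x ∨₁ 0 and x˜⁻ ≡ x ∨₂ 0 hold by definition.
proposition5p20 : {a ℓ : Level} (A : BoundedPseudoBEAlgebra a)
    (D : BoundedPseudoBEAlgebra.Carrier A → Set ℓ) →
    IsFantasticDS (BoundedPseudoBEAlgebra.pbe A) D → IsInvolutiveDS A D
proposition5p20 A D fantastic = record
  { isDS        = isDS
  ; involutive₁ = λ x → fantastic₁ x 𝟘 (ds-contains-≤ pbe isDS (𝟘-least x))
  ; involutive₂ = λ x → fantastic₂ x 𝟘 (ds-contains-≤˜ pbe isDS (𝟘-least x))
  }
  where
  open BoundedPseudoBEAlgebra A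
  open IsFantasticDS fantastic
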